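{- Let $\Psi$ be a weighted directed graph with finite vertex set ${\tt N}$ and arc weights $\psi_{ij}$, let $\aleph$ be a partition of ${\tt N}$ by which $\Psi$ is tree-divisible, let $F'\in{\cal F}^k(\Psi|\aleph)$ and let $F$ be a minimal principal of $F'$. Let ${\tt X}\in\aleph$ contain no root of $F$, let $(x,y)$ be the unique arc of $F$ leaving ${\tt X}$ (i.e. $x\in{\tt X}$, $y\notin{\tt X}$), and let ${\tt Y}\in\aleph$ be the set containing $y$. Then $$f'_{\tt XY}=\psi^\aleph_{\tt XY}\ \ge\ \psi_{xy}=f^\aleph_{\tt XY}.$$ Moreover, equality holds when $F|_{\tt X}\in\tilde{\cal T}^\bullet_{\tt X}$.
   Context: An entering forest is a directed graph in which at most one arc leaves each vertex and there are no directed cycles; its components are entering trees, whose root is the unique vertex with no outgoing arc. ${\cal F}^k(G)$ is the set of spanning entering forests of $G$ with exactly $k$ trees. For a subgraph $G$ of $\Psi$ and ${\tt D}\subseteq{\tt N}$, $\Upsilon^G_{\tt D}=\sum_{(i,j)\in{\tt A}G,\ i\in{\tt D}}\psi_{ij}$, $\Upsilon^G=\Upsilon^G_{\tt N}$; $G|_{\tt D}$ is the induced subgraph. For a spanning subgraph $G$ of $\Psi$ and ${\tt D}\subseteq{\tt N}$: ${\cal T}^\bullet_{\tt D}(G)$ is the set of entering trees in $G$ with vertex set ${\tt D}$, $\lambda^\bullet_{\tt D}(G)=\min_{T\in{\cal T}^\bullet_{\tt D}(G)}\Upsilon^T$, and $\tilde{\cal T}^\bullet_{\tt D}(G)$ is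 the set of $T\in{\cal T}^\bullet_{\tt D}(G)$ with $\Upsilon^T=\lambda^\bullet_{\tt D}(G)$; ${\cal T}^\circ_{\tt D}(G)$ is the set of entering trees $T\subseteq G$ with ${\tt D}\subset{\tt V}T$, $|{\tt V}T|=|{\tt D}|+1$, $T|_{\tt D}\in{\cal T}^\bullet_{\tt D}(G)$. For distinct ${\tt X},{\tt Y}\in\aleph$, ${\cal T}_{\tt XY}(G)$ is the set of $T\in{\cal T}^\circ_{\tt X}(G)$ with root in ${\tt Y}$, $\lambda_{\tt XY}(G)=\min_{T\in{\cal T}_{\tt XY}(G)}\Upsilon^T$. When $G=\Psi$ the argument is omitted. $G$ is tree-divisible by $\aleph$ if ${\cal T}^\bullet_{\tt X}(G)\ne\emptyset$ for all ${\tt X}\in\aleph$. The splitting $G|\aleph=G^\aleph$ of a tree-divisible $G$ has vertex set $\aleph$ and an arc $({\tt X},{\tt Y})$, ${\tt X}\ne{\tt Y}$, iff ${\cal T}_{\tt XY}(G)\ne\emptyset$, of weight $\lambda_{\tt XY}(G)-\lambda^\bullet_{\tt X}(G)$; write $\psi^\aleph_{\tt XY}=\lambda_{\tt XY}-\lambda^\bullet_{\tt X}$ for the weights of $\Psi^\aleph$ and $f^\aleph_{\tt XY}=\lambda_{\tt XY}(F)-\lambda^\bullet_{\tt X}(F)$ for the weights of $F^\aleph$. A tree-divisible $F\in{\cal F}^k(\Psi)$ is a principal of a spanning entering forest $F'$ of $\Psi|\aleph$ if the arc set of $F'$ equals that of $F^\aleph$; arcs of $F'$ carry their weights in $\Psi^\aleph$,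 denoted $f'_{\tt XY}$. A minimal principal of $F'$ is a principal of minimal weight $\Upsilon^F$ among all principals of $F'$. -}

module Defs where

open import Data.Nat using (ℕ; zero; suc)
open import Data.Fin using (Fin; zero; suc; _≟_)
open import Data.Bool using (Bool; true; false; _∧_; if_then_else_)
open import Data.Product using (Σ; ∃; _×_; _,_)
open import Data.Sum using (_⊎_)
open import Relation.Nullary using (¬_; does)
open import Relation.Binary.PropositionalEquality using (_≡_; _≢_)
open import Relation.Binary.Construct.Closure.Transitive using (TransClosure)
open import Relation.Binary.Construct.Closure.ReflexiveTransitive using (Star)

-- Weights: an arbitrary totally ordered abelian group (covers ℝ, ℚ, ℤ).

record OrdAbGroup : Set₁ where
  infixl 6 _+_ _-_
  infix 4 _≤_
  field
    Carrier   : Set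
    _+_       : Carrier → Carrier → Carrier
    0#        : Carrier
    -_        : Carrier → Carrier
    _≤_       : Carrier → Carrier → Set
    +-assoc   : ∀ x y z → (x + y) + z ≡ x + (y + z)
    +-comm    : ∀ x y → x + y ≡ y + x
    +-identityˡ : ∀ x → 0# + x ≡ x
    -‿inverseˡ : ∀ x → (- x) + x ≡ 0#
    ≤-refl    : ∀ x → x ≤ x
    ≤-trans   : ∀ {x y z} → x ≤ y → y ≤ z → x ≤ z
    ≤-antisym : ∀ {x y} → x ≤ y → y ≤ x → x ≡ y
    ≤-total   : ∀ x y → x ≤ y ⊎ y ≤ x
    +-monoˡ-≤ : ∀ {x y} z → x ≤ y → x + z ≤ y + z

  _-_ : Carrier → Carrier → Carrier
  x - y = x + (- y)

record Graph (n : ℕ) : Set where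
  field
    V : Fin n → Bool
    A : Fin n → Fin n → Bool
open Graph public

VSet : ℕ → Set
VSet n = Fin n → Bool

_∈ᵥ_ : ∀ {n} → Fin n → VSet n → Set
i ∈ᵥ D = D i ≡ true

Arc : ∀ {n} → Graph n → Fin n → Fin n → Set
Arc G i j = A G i j ≡ true

card : ∀ {n} → VSet n → ℕ
card {zero}  D = zero
card {suc n} D = (if D zero then suc else (λ k → k)) (card (λ i → D (suc i)))

full : ∀ {n} → (Fin n → Fin n → Bool) → Graph n
full E = record { V = λ _ → true ; A = E }

WellFormed : ∀ {n} → Graph n → Set
WellFormed G = ∀ i j → Arc G i j → (i ∈ᵥ V G) × (j ∈ᵥ V G)

_⊆G_ : ∀ {n} → Graph n → Graph n → Set
G ⊆G H = (∀ i → i ∈ᵥ V G → i ∈ᵥ V H) × (∀ i j → Arc G i j → Arc H i j)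

Spanning : ∀ {n} → Graph n → Set
Spanning G = ∀ i → i ∈ᵥ V G

_∣_ : ∀ {n} → Graph n → VSet n → Graph n
G ∣ D = record { V = λ i → V G i ∧ D i ; A = λ i j → A G i j ∧ (D i ∧ D j) }

IsEnteringForest : ∀ {n} → Graph n → Set
IsEnteringForest G =
  WellFormed G
  × (∀ i j j′ → Arc G i j → Arc G i j′ → j ≡ j′)
  × (∀ i → ¬ TransClosure (Arc G) i i)

UArc : ∀ {n} → Graph n → Fin n → Fin n → Set
UArc G i j = Arc G i j ⊎ Arc G j i

WConn : ∀ {n} → Graph n → Fin n → Fin n → Set
WConn G = Star (UArc G)

IsEnteringTree : ∀ {n} → Graph n → Set
IsEnteringTree G =
  IsEnteringForest G
  × (∃ λ i → i ∈ᵥ V G)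
  × (∀ i j → i ∈ᵥ V G → j ∈ᵥ V G → WConn G i j)

HasComponents : ∀ {n} → Graph n → ℕ → Set
HasComponents {n} G k =
  Σ (Fin n → Fin k) λ c →
    (∀ t → ∃ λ i → i ∈ᵥ V G × c i ≡ t)
    × (∀ i j → i ∈ᵥ V G → j ∈ᵥ V G →
         (c i ≡ c j → WConn G i j) × (WConn G i j → c i ≡ c j))

InForests : ∀ {n} → ℕ → Graph n → Graph n → Set
InForests k G F = Spanning F × F ⊆G G × IsEnteringForest F × HasComponents F k

IsRoot : ∀ {n} → Graph n → Fin n → Set
IsRoot T r = r ∈ᵥ V T × (∀ j → ¬ Arc T r j)

TreeOn : ∀ {n} → Graph n → VSet n → Graph n → Set
TreeOn G D T = T ⊆G G × IsEnteringTree T × (∀ i → V T i ≡ D i)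

TreeOnPlus : ∀ {n} → Graph n → VSet n → Graph n → Set
TreeOnPlus G D T =
  IsEnteringTree T × T ⊆G G
  × ((∀ i → i ∈ᵥ D → i ∈ᵥ V T) × ¬ (∀ i → V T i ≡ D i))
  × card (V T) ≡ suc (card D)
  × TreeOn G D (T ∣ D)

-- Partitions ℵ of Fin n into m nonempty blocks, given by blk : Fin n → Fin m

IsPartition : ∀ {n m} → (Fin n → Fin m) → Set
IsPartition blk = ∀ X → ∃ λ i → blk i ≡ X

block : ∀ {n m} → (Fin n → Fin m) → Fin m → VSet n
block blk X i = does (blk i ≟ X)

TreeXY : ∀ {n m} → Graph n → (Fin n → Fin m) → Fin m → Fin m → Graph n → Set
TreeXY G blk X Y T =
  TreeOnPlus G (block blk X) T × (∃ λ r → IsRoot T r × blk r ≡ Y)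

TreeDivisible : ∀ {n m} → Graph n → (Fin n → Fin m) → Set
TreeDivisible G blk = ∀ X → ∃ λ T → TreeOn G (block blk X) T

SplitArc : ∀ {n m} → Graph n → (Fin n → Fin m) → Fin m → Fin m → Set
SplitArc G blk X Y = X ≢ Y × (∃ λ T → TreeXY G blk X Y T)

-- F′ is a spanning entering forest of Ψ|ℵ with exactly k trees
-- (F′ is a graph on the vertex set ℵ ≅ Fin m)
InSplitForests : ∀ {n m} → ℕ → Graph n → (Fin n → Fin m) → Graph m → Set
InSplitForests k Ψ blk F′ =
  Spanning F′ × (∀ X Y → Arc F′ X Y → SplitArc Ψ blk X Y)
  × IsEnteringForest F′ × HasComponents F′ k

module Weighted (𝔾 : OrdAbGroup) where
  open OrdAbGroup 𝔾 public

  sumFin : ∀ {n} → (Fin n → Carrier) → Carrier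
  sumFin {zero}  f = 0#
  sumFin {suc n} f = f zero + sumFin (λ i → f (suc i))

  module _ {n : ℕ} (ψ : Fin n → Fin n → Carrier) where

    ΥD : Graph n → VSet n → Carrier
    ΥD G D = sumFin λ i → sumFin λ j → if A G i j ∧ D i then ψ i j else 0#

    Υ : Graph n → Carrier
    Υ G = ΥD G (λ _ → true)

    IsMin : (Graph n → Set) → (Graph n → Carrier) → Carrier → Set
    IsMin P c l = (∃ λ T → P T × c T ≡ l) × (∀ T → P T → l ≤ c T)

    IsLamBullet : Graph n → VSet n → Carrier → Set
    IsLamBullet G D l = IsMin (TreeOn G D) Υ l

    IsLamXY : ∀ {m} → Graph n → (Fin n → Fin m) → Fin m → Fin m → Carrier → Set
    IsLamXY G blk X Y l = IsMin (TreeXY G blk X Y) Υ l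

    IsTildeTree : Graph n → VSet n → Graph n → Set
    IsTildeTree G D T = TreeOn G D T × (∀ T′ → TreeOn G D T′ → Υ T ≤ Υ T′)

    IsPrincipal : ∀ {m} → ℕ → (Fin n → Fin n → Bool) → (Fin n → Fin m)
                → Graph m → Graph n → Set
    IsPrincipal k E blk F′ F =
      InForests k (full E) F × TreeDivisible F blk
      × (∀ X Y → (Arc F′ X Y → SplitArc F blk X Y) × (SplitArc F blk X Y → Arc F′ X Y))

    IsMinimalPrincipal : ∀ {m} → ℕ → (Fin n → Fin n → Bool) → (Fin n → Fin m)
                       → Graph m → Graph n → Set
    IsMinimalPrincipal k E blk F′ F =
      IsPrincipal k E blk F′ F
      × (∀ G → IsPrincipal k E blk F′ G → Υ F ≤ Υ G)

{-# OPTIONS --safe #-}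
-- Write Y for the block of y and T₀ for F|_X together with the arc (x , y). Since F is
-- functional and x is the only vertex of X whose arc leaves X, the trees of 𝒯•_X(F) and
-- 𝒯_XY(F) are exactly F|_X and T₀; so (X , Y) is an arc of F^ℵ, hence of F′, and
-- f^ℵ_XY = Υ T₀ - Υ F|_X = ψ_xy. For the inequality take T ∈ 𝒯_XY(Ψ) and let G be F with
-- the arcs leaving X replaced by those of T. A cycle of G either stays in one block, where
-- G agrees with T or with F, or projects to a cycle of F′; G crosses between the same
-- blocks as F and has the same components, so G is again a principal of F′. Minimality
-- of F gives Υ F ≤ Υ G, i.e. Υ F|_X + ψ_xy ≤ Υ T, and λ•_X ≤ Υ F|_X gives ψ_xy ≤ ψ^ℵ_XY.
-- When F|_X is a minimal tree, λ•_X = Υ F|_X and T₀ shows λ_XY ≤ Υ F|_X + ψ_xy.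

module Submission where

open import Defs
open import Data.Nat as ℕ using (ℕ; zero; suc; z≤n; s≤s)
import Data.Nat.Properties as ℕₚ
open import Data.Fin using (Fin; zero; suc; _≟_)
open import Data.Bool using (Bool; true; false; _∧_; _∨_; not; if_then_else_)
open import Data.Bool.Properties
  using (∧-conicalˡ; ∧-conicalʳ; ∧-comm; ∧-abs-∨; ∧-identityʳ; ∨-identityʳ; not-injective)
open import Data.Product using (∃; ∃₂; _×_; _,_; proj₁; proj₂)
open import Data.Sum as Sum using (_⊎_; inj₁; inj₂)
open import Function using (_∘_; _⇔_; mk⇔; Equivalence)
open import Relation.Nullary using (¬_; does; yes; no; contradiction)
open import Relation.Nullary.Decidable using (dec-true; dec-false)
open import Relation.Binary.PropositionalEquality
  using (_≡_; _≢_; refl; sym; trans; cong; cong₂; subst; subst₂; module ≡-Reasoning)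
open import Relation.Binary.Construct.Closure.Transitive using (TransClosure; [_]; _∷_)
open import Relation.Binary.Construct.Closure.ReflexiveTransitive as Star using (Star; ε; _◅_; _◅◅_)

true≢false : ∀ {b} → b ≡ true → b ≢ false
true≢false refl ()

true-or-false : ∀ b → b ≡ true ⊎ b ≡ false
true-or-false true  = inj₁ refl
true-or-false false = inj₂ refl

∧-intro : ∀ {a b} → a ≡ true → b ≡ true → a ∧ b ≡ true
∧-intro refl refl = refl

∨-introˡ : ∀ {a} b → a ≡ true → a ∨ b ≡ true
∨-introˡ b refl = refl

∨-introʳ : ∀ a {b} → b ≡ true → a ∨ b ≡ true
∨-introʳ true  _ = refl
∨-introʳ false p = p

∨-elim : ∀ {a b} → a ∨ b ≡ true → a ≡ true ⊎ b ≡ true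
∨-elim {true}  _ = inj₁ refl
∨-elim {false} p = inj₂ p

∧-assoc-dup : ∀ a b c → (a ∧ b) ∧ (b ∧ c) ≡ a ∧ (b ∧ c)
∧-assoc-dup false _     _ = refl
∧-assoc-dup true  true  _ = refl
∧-assoc-dup true  false _ = refl

≡true-ext : ∀ {a b} → (a ≡ true ⇔ b ≡ true) → a ≡ b
≡true-ext {true}  {true}  _   = refl
≡true-ext {true}  {false} a⇔b = sym (Equivalence.to a⇔b refl)
≡true-ext {false} {true}  a⇔b = Equivalence.from a⇔b refl
≡true-ext {false} {false} _   = refl

does-true : ∀ {n} {i j : Fin n} → does (i ≟ j) ≡ true → i ≡ j
does-true {i = i} {j} p with i ≟ j
... | yes i≡j = i≡j

module _ {n m : ℕ} (blk : Fin n → Fin m) where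

  ∈-block⁺ : ∀ {Z i} → blk i ≡ Z → block blk Z i ≡ true
  ∈-block⁺ {Z} {i} = dec-true (blk i ≟ Z)

  ∉-block⁺ : ∀ {Z i} → blk i ≢ Z → block blk Z i ≡ false
  ∉-block⁺ {Z} {i} = dec-false (blk i ≟ Z)

  ∈-block⁻ : ∀ {Z i} → block blk Z i ≡ true → blk i ≡ Z
  ∈-block⁻ = does-true

  block-cong : ∀ {Z a b} → blk a ≡ blk b → block blk Z a ≡ block blk Z b
  block-cong {Z} = cong (λ W → does (W ≟ Z))

_⊆ᵥ_ : ∀ {n} → VSet n → VSet n → Set
D ⊆ᵥ V = ∀ i → i ∈ᵥ D → i ∈ᵥ V

insert : ∀ {n} → VSet n → Fin n → VSet n
insert D w i = D i ∨ does (i ≟ w)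

insert-⊆ᵥ : ∀ {n} {D V : VSet n} {w} → D ⊆ᵥ V → w ∈ᵥ V → insert D w ⊆ᵥ V
insert-⊆ᵥ {V = V} D⊆V w∈V i p with ∨-elim p
... | inj₁ i∈D = D⊆V i i∈D
... | inj₂ i≡w = subst (_∈ᵥ V) (sym (does-true i≡w)) w∈V

card-cong : ∀ {n} {D V : VSet n} → (∀ i → D i ≡ V i) → card D ≡ card V
card-cong {zero}  _   = refl
card-cong {suc n} {D} {V} D≗V rewrite D≗V zero =
  cong (if V zero then suc else (λ c → c)) (card-cong {D = D ∘ suc} {V ∘ suc} (D≗V ∘ suc))

card-mono : ∀ {n} {D V : VSet n} → D ⊆ᵥ V → card D ℕ.≤ card V
card-mono {zero} _ = z≤n
card-mono {suc n} {D} {V} D⊆V with D zero in D₀ | V zero in V₀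
... | true  | true  = s≤s (card-mono (λ i → D⊆V (suc i)))
... | true  | false = contradiction (D⊆V zero D₀) (λ p → true≢false p V₀)
... | false | true  = ℕₚ.m≤n⇒m≤1+n (card-mono (λ i → D⊆V (suc i)))
... | false | false = card-mono (λ i → D⊆V (suc i))

card-insert : ∀ {n} {D : VSet n} {w} → D w ≡ false → card (insert D w) ≡ suc (card D)
card-insert {suc n} {D} {zero} w∉D
  rewrite w∉D = cong suc (card-cong (λ i → ∨-identityʳ (D (suc i))))
card-insert {suc n} {D} {suc w} w∉D with D zero
... | true  = cong suc (card-insert {D = D ∘ suc} w∉D)
... | false = card-insert {D = D ∘ suc} w∉D

-- Two distinct new points would make V at least two larger than D.
card-≡suc⇒unique-new : ∀ {n} {D V : VSet n} → D ⊆ᵥ V → card V ≡ suc (card D)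
  → ∀ {a b} → a ∈ᵥ V → D a ≡ false → b ∈ᵥ V → D b ≡ false → a ≡ b
card-≡suc⇒unique-new {D = D} {V} D⊆V |V|≡ {a} {b} a∈V a∉D b∈V b∉D with a ≟ b
... | yes a≡b = a≡b
... | no a≢b = contradiction (subst₂ ℕ._≤_ |D₂| |V|≡ (card-mono D₂⊆V)) (λ le → ℕₚ.1+n≰n (ℕₚ.≤-pred le))
  where
  b∉D₁ : insert D a b ≡ false
  b∉D₁ rewrite b∉D = dec-false (b ≟ a) (a≢b ∘ sym)
  D₂⊆V : insert (insert D a) b ⊆ᵥ V
  D₂⊆V = insert-⊆ᵥ (insert-⊆ᵥ D⊆V a∈V) b∈V
  |D₂| : card (insert (insert D a) b) ≡ suc (suc (card D))
  |D₂| = trans (card-insert {D = insert D a} b∉D₁) (cong suc (card-insert {D = D} a∉D))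

Acyclic : {A : Set} → (A → A → Set) → Set
Acyclic R = ∀ i → ¬ TransClosure R i i

module _ {A : Set} {R S : A → A → Set} where

  ⁺-map : (∀ {i j} → R i j → S i j) → ∀ {i j} → TransClosure R i j → TransClosure S i j
  ⁺-map f [ r ]    = [ f r ]
  ⁺-map f (r ∷ rs) = f r ∷ ⁺-map f rs

  acyclic-⇒ : (∀ {i j} → R i j → S i j) → Acyclic S → Acyclic R
  acyclic-⇒ f acyclic i cycle = acyclic i (⁺-map f cycle)

module _ {A B : Set} (blk : A → B) where

  Inside : (A → A → Set) → A → A → Set
  Inside R a b = R a b × blk a ≡ blk b

  project⁺ : ∀ {R : A → A → Set} {S : B → B → Set}
           → (∀ {a b} → R a b → blk a ≡ blk b ⊎ S (blk a) (blk b))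
           → ∀ {u v} → TransClosure R u v
           → TransClosure S (blk u) (blk v) ⊎ (blk u ≡ blk v × TransClosure (Inside R) u v)
  project⁺ step [ r ] with step r
  ... | inj₁ same  = inj₂ (same , [ (r , same) ])
  ... | inj₂ cross = inj₁ [ cross ]
  project⁺ {S = S} step {v = v} (r ∷ rs) with step r | project⁺ step rs
  ... | inj₁ same  | inj₁ path           = inj₁ (subst (λ Z → TransClosure S Z (blk v)) (sym same) path)
  ... | inj₁ same  | inj₂ (same′ , path) = inj₂ (trans same same′ , (r , same) ∷ path)
  ... | inj₂ cross | inj₁ path           = inj₁ (cross ∷ path)
  ... | inj₂ cross | inj₂ (same′ , _)    = inj₁ [ subst (S _) same′ cross ]

  inside⁺⇒ : ∀ {R S : A → A → Set} {Z} → (∀ {a b} → blk a ≡ Z → R a b → S a b)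
           → ∀ {u v} → blk u ≡ Z → TransClosure (Inside R) u v → TransClosure S u v
  inside⁺⇒ f u∈Z [ (r , _) ]        = [ f u∈Z r ]
  inside⁺⇒ f u∈Z ((r , same) ∷ rs) = f u∈Z r ∷ inside⁺⇒ f (trans (sym same) u∈Z) rs

  acyclic-by-blocks : ∀ {R : A → A → Set} {S : B → B → Set}
                    → (∀ {a b} → R a b → blk a ≡ blk b ⊎ S (blk a) (blk b))
                    → Acyclic S → Acyclic (Inside R) → Acyclic R
  acyclic-by-blocks step acyclicS acyclicInside i cycle with project⁺ step cycle
  ... | inj₁ blockCycle       = acyclicS (blk i) blockCycle
  ... | inj₂ (_ , innerCycle) = acyclicInside i innerCycle

module _ {n : ℕ} where

  Functional : Graph n → Set
  Functional G = ∀ i j j′ → Arc G i j → Arc G i j′ → j ≡ j′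

  Sink : Graph n → Fin n → Set
  Sink G r = ∀ j → ¬ Arc G r j

  _⊆ᴬ_ : Graph n → Graph n → Set
  G ⊆ᴬ H = ∀ i j → Arc G i j → Arc H i j

  _≐ᴬ_ : Graph n → Graph n → Set
  G ≐ᴬ H = ∀ i j → Arc G i j ⇔ Arc H i j

  functional-⊆ᴬ : ∀ {G H} → G ⊆ᴬ H → Functional H → Functional G
  functional-⊆ᴬ G⊆H fn i j j′ a a′ = fn i j j′ (G⊆H i j a) (G⊆H i j′ a′)

  acyclic-⊆ᴬ : ∀ {G H} → G ⊆ᴬ H → Acyclic (Arc H) → Acyclic (Arc G)
  acyclic-⊆ᴬ G⊆H = acyclic-⇒ (G⊆H _ _)

  wconn-sym : ∀ {G : Graph n} {i j} → WConn G i j → WConn G j i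
  wconn-sym {G} = Star.reverse {T = UArc G} Sum.swap

  wconn-⊆ᴬ : ∀ {G H} → G ⊆ᴬ H → ∀ {i j} → WConn G i j → WConn H i j
  wconn-⊆ᴬ G⊆H = Star.map (Sum.map (G⊆H _ _) (G⊆H _ _))

  wconn-bind : ∀ {G H} → (∀ a b → Arc G a b → WConn H a b) → ∀ {i j} → WConn G i j → WConn H i j
  wconn-bind {G} {H} f = Star._⋆ (Sum.[ f _ _ , wconn-sym {H} ∘ f _ _ ])

  HasComponents-transfer : ∀ {G H : Graph n} {k} → (∀ i → V H i ≡ V G i)
                         → (∀ a b → Arc G a b → WConn H a b) → (∀ a b → Arc H a b → WConn G a b)
                         → HasComponents G k → HasComponents H k
  HasComponents-transfer {G} {H} V≗ G⇒H H⇒G (c , onto , same⇔conn) =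
    c , (λ t → let (i , i∈G , ci≡t) = onto t in i , trans (V≗ i) i∈G , ci≡t)
      , λ i j i∈H j∈H → let (to , from) = same⇔conn i j (∈G i∈H) (∈G j∈H)
                        in wconn-bind {G} {H} G⇒H ∘ to , from ∘ wconn-bind {H} {G} H⇒G
    where
    ∈G : ∀ {i} → i ∈ᵥ V H → i ∈ᵥ V G
    ∈G {i} = trans (sym (V≗ i))

  -- Along the weak path, a forward arc u → v is the first step of the walk from u
  -- (functionality), and a backward arc v → u is prepended to it.
  reaches-sink : ∀ {T r} → Functional T → Sink T r
               → ∀ {u v} → WConn T u v → Star (Arc T) u r → Star (Arc T) v r
  reaches-sink fn sink ε               walk        = walk
  reaches-sink fn sink (inj₁ a ◅ path) ε           = contradiction a (sink _)
  reaches-sink {T} {r} fn sink (inj₁ a ◅ path) (a′ ◅ walk) =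
    reaches-sink {T} {r} fn sink path (subst (λ z → Star (Arc T) z r) (fn _ _ _ a′ a) walk)
  reaches-sink {T} {r} fn sink (inj₂ a ◅ path) walk = reaches-sink {T} {r} fn sink path (a ◅ walk)

  tree-reaches-sink : ∀ {T r} → IsEnteringTree T → r ∈ᵥ V T → Sink T r
                    → ∀ {z} → z ∈ᵥ V T → Star (Arc T) z r
  tree-reaches-sink {T} {r} ((_ , fn , _) , _ , conn) r∈T sink z∈T =
    reaches-sink {T} {r} fn sink (conn _ _ r∈T z∈T) ε

  tree-out-arc : ∀ {T H r} → IsEnteringTree T → T ⊆ᴬ H → Functional H → r ∈ᵥ V T → Sink T r
               → ∀ {i j} → i ∈ᵥ V T → Arc H i j → i ≡ r ⊎ Arc T i j
  tree-out-arc {T} t T⊆H fnH r∈T sink {i} {j} i∈T h with tree-reaches-sink t r∈T sink i∈T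
  ... | ε      = inj₁ refl
  ... | a ◅ _  = inj₂ (subst (Arc T i) (fnH _ _ _ (T⊆H _ _ a) h) a)

  IsEnteringTree-≐ᴬ : ∀ {G H} → (∀ i → V G i ≡ V H i) → G ≐ᴬ H → IsEnteringTree G → IsEnteringTree H
  IsEnteringTree-≐ᴬ {G} {H} V≗ G≐H ((wf , fn , ac) , (r , r∈G) , conn) =
    (wfH , functional-⊆ᴬ {H} {G} H⊆G fn , acyclic-⊆ᴬ {H} {G} H⊆G ac) , (r , ∈H r∈G)
    , λ i j i∈H j∈H → wconn-⊆ᴬ {G} {H} G⊆H (conn i j (∈G i∈H) (∈G j∈H))
    where
    G⊆H : G ⊆ᴬ H
    G⊆H i j = Equivalence.to (G≐H i j)
    H⊆G : H ⊆ᴬ G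
    H⊆G i j = Equivalence.from (G≐H i j)
    ∈H : ∀ {i} → i ∈ᵥ V G → i ∈ᵥ V H
    ∈H {i} = trans (sym (V≗ i))
    ∈G : ∀ {i} → i ∈ᵥ V H → i ∈ᵥ V G
    ∈G {i} = trans (V≗ i)
    wfH : WellFormed H
    wfH i j h = let (i∈G , j∈G) = wf i j (H⊆G i j h) in ∈H i∈G , ∈H j∈G

  TreeOn-≐ᴬ : ∀ {K D G H} → G ≐ᴬ H → (∀ i → V H i ≡ D i) → TreeOn K D G → TreeOn K D H
  TreeOn-≐ᴬ {G = G} {H} G≐H VH≗D ((V⊆K , A⊆K) , t , VG≗D) =
    ((λ i i∈H → V⊆K i (trans (V≗ i) i∈H)) , (λ i j h → A⊆K i j (Equivalence.from (G≐H i j) h)))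
    , IsEnteringTree-≐ᴬ V≗ G≐H t , VH≗D
    where
    V≗ : ∀ i → V G i ≡ V H i
    V≗ i = trans (VG≗D i) (sym (VH≗D i))

  TreeOn-⊆ᴬ : ∀ {H G T : Graph n} {D} → Spanning G → T ⊆ᴬ G → TreeOn H D T → TreeOn G D T
  TreeOn-⊆ᴬ spanning T⊆G (_ , t , V≗D) = ((λ i _ → spanning i) , T⊆G) , t , V≗D

  ⊆G-trans : ∀ {G H K : Graph n} → G ⊆G H → H ⊆G K → G ⊆G K
  ⊆G-trans (V⊆ , A⊆) (V⊆′ , A⊆′) = (λ i → V⊆′ i ∘ V⊆ i) , (λ i j → A⊆′ i j ∘ A⊆ i j)

  TreeOn-⊆G : ∀ {H K} → H ⊆G K → ∀ {D T} → TreeOn H D T → TreeOn K D T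
  TreeOn-⊆G {H} {K} H⊆K {T = T} (T⊆H , t , V≗D) = ⊆G-trans {T} {H} {K} T⊆H H⊆K , t , V≗D

  TreeOnPlus-⊆G : ∀ {H K} → H ⊆G K → ∀ {D T} → TreeOnPlus H D T → TreeOnPlus K D T
  TreeOnPlus-⊆G {H} {K} H⊆K {T = T} (t , T⊆H , D⊂T , |T| , onD) =
    t , ⊆G-trans {T} {H} {K} T⊆H H⊆K , D⊂T , |T| , TreeOn-⊆G {H} {K} H⊆K onD

  ≗ᴬ⇒≐ᴬ : ∀ {G H : Graph n} → (∀ i j → A G i j ≡ A H i j) → G ≐ᴬ H
  ≗ᴬ⇒≐ᴬ A≗ i j = mk⇔ (trans (sym (A≗ i j))) (trans (A≗ i j))

  ∣-arc⁻ : ∀ (G : Graph n) (D : VSet n) {i j} → Arc (G ∣ D) i j → Arc G i j × i ∈ᵥ D × j ∈ᵥ D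
  ∣-arc⁻ G D {i} {j} h = ∧-conicalˡ (A G i j) _ h , ∧-conicalˡ (D i) (D j) h′ , ∧-conicalʳ (D i) (D j) h′
    where h′ = ∧-conicalʳ (A G i j) (D i ∧ D j) h

  arcGraph : Fin n → Fin n → Graph n
  arcGraph x y = record { V = λ i → does (i ≟ x) ∨ does (i ≟ y) ; A = λ i j → does (i ≟ x) ∧ does (j ≟ y) }

  module TreeWithExit {H : Graph n} (fnH : Functional H) {D : VSet n} {T : Graph n} (onD : TreeOn H D T)
                      {z w : Fin n} (z∈D : z ∈ᵥ D) (w∉D : D w ≡ false) (zw : Arc H z w) where

    T⊆H : T ⊆ᴬ H
    T⊆H = proj₂ (proj₁ onD)

    tree : IsEnteringTree T
    tree = proj₁ (proj₂ onD)

    ∈T : ∀ {i} → i ∈ᵥ D → i ∈ᵥ V T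
    ∈T {i} = trans (proj₂ (proj₂ onD) i)

    ∈D : ∀ {i} → i ∈ᵥ V T → i ∈ᵥ D
    ∈D {i} = trans (sym (proj₂ (proj₂ onD) i))

    D⊆H : D ⊆ᵥ V H
    D⊆H i = proj₁ (proj₁ onD) i ∘ ∈T

    source∈D : ∀ {i j} → Arc T i j → i ∈ᵥ D
    source∈D a = ∈D (proj₁ (proj₁ (proj₁ tree) _ _ a))

    target∈D : ∀ {i j} → Arc T i j → j ∈ᵥ D
    target∈D a = ∈D (proj₂ (proj₁ (proj₁ tree) _ _ a))

    exit-sink : Sink T z
    exit-sink j a = true≢false (subst (_∈ᵥ D) (fnH z j w (T⊆H z j a) zw) (target∈D a)) w∉D

    out-arc : ∀ {i j} → i ∈ᵥ D → Arc H i j → i ≡ z ⊎ Arc T i j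
    out-arc i∈D = tree-out-arc {T} {H} tree T⊆H fnH (∈T z∈D) exit-sink (∈T i∈D)

    arc-from-D : ∀ {i j} → i ∈ᵥ D → Arc H i j → j ∈ᵥ D ⊎ (i ≡ z × j ≡ w)
    arc-from-D i∈D h with out-arc i∈D h
    ... | inj₁ refl = inj₂ (refl , fnH _ _ _ h zw)
    ... | inj₂ a    = inj₁ (target∈D a)

    tree≐restriction : T ≐ᴬ (H ∣ D)
    tree≐restriction i j = mk⇔ (λ a → ∧-intro (T⊆H i j a) (∧-intro (source∈D a) (target∈D a))) from
      where
      from : Arc (H ∣ D) i j → Arc T i j
      from h with ∣-arc⁻ H D h
      ... | h′ , i∈D , j∈D with out-arc i∈D h′
      ... | inj₂ a    = a
      ... | inj₁ refl = contradiction (subst (_∈ᵥ D) (fnH _ _ _ h′ zw) j∈D) (λ w∈D → true≢false w∈D w∉D)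

    restriction-∈-TreeOn : TreeOn H D (H ∣ D)
    restriction-∈-TreeOn =
      TreeOn-≐ᴬ {G = T} tree≐restriction
        (λ i → ≡true-ext (mk⇔ (∧-conicalʳ (V H i) (D i)) (λ i∈D → ∧-intro (D⊆H i i∈D) i∈D))) onD

  module Extension {H : Graph n} (forest : IsEnteringForest H) {D : VSet n} {T : Graph n} (onD : TreeOn H D T)
                   {z w : Fin n} (z∈D : z ∈ᵥ D) (w∉D : D w ≡ false) (zw : Arc H z w) where

    open TreeWithExit (proj₁ (proj₂ forest)) onD z∈D w∉D zw

    extension : Graph n
    extension = record { V = insert D w ; A = λ i j → A H i j ∧ D i }

    extension-arc⁻ : ∀ {i j} → Arc extension i j → Arc H i j × i ∈ᵥ D
    extension-arc⁻ {i} {j} a = ∧-conicalˡ (A H i j) (D i) a , ∧-conicalʳ (A H i j) (D i) a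

    private
      w∈ext : w ∈ᵥ insert D w
      w∈ext = ∨-introʳ (D w) (dec-true (w ≟ w) refl)

      D⊆ext : D ⊆ᵥ insert D w
      D⊆ext i = ∨-introˡ (does (i ≟ w))

      ext⊆H : extension ⊆ᴬ H
      ext⊆H i j = proj₁ ∘ extension-arc⁻

      wellFormed : WellFormed extension
      wellFormed i j a with extension-arc⁻ a
      ... | h , i∈D with arc-from-D i∈D h
      ... | inj₁ j∈D        = D⊆ext i i∈D , D⊆ext j j∈D
      ... | inj₂ (_ , refl) = D⊆ext i i∈D , w∈ext

      connected-to-z : ∀ {i} → i ∈ᵥ insert D w → WConn extension i z
      connected-to-z {i} i∈ext with ∨-elim i∈ext
      ... | inj₁ i∈D = wconn-⊆ᴬ {T} {extension} (λ a b t → ∧-intro (T⊆H a b t) (source∈D t))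
                                 (proj₂ (proj₂ tree) i z (∈T i∈D) (∈T z∈D))
      ... | inj₂ i≡w = subst (λ v → WConn extension v z) (sym (does-true i≡w)) (inj₂ (∧-intro zw z∈D) ◅ ε)

    extension-isTree : IsEnteringTree extension
    extension-isTree =
      ( wellFormed
      , functional-⊆ᴬ {extension} {H} ext⊆H (proj₁ (proj₂ forest))
      , acyclic-⊆ᴬ {extension} {H} ext⊆H (proj₂ (proj₂ forest)))
      , (z , D⊆ext z z∈D)
      , λ i j i∈ext j∈ext → connected-to-z i∈ext ◅◅ wconn-sym {extension} (connected-to-z j∈ext)

    extension-root : IsRoot extension w
    extension-root = w∈ext , λ j a → true≢false (proj₂ (extension-arc⁻ a)) w∉D

    extension-∈-TreeOnPlus : TreeOnPlus H D extension
    extension-∈-TreeOnPlus =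
      extension-isTree
      , (insert-⊆ᵥ D⊆H (proj₂ (proj₁ forest z w zw)) , ext⊆H)
      , (D⊆ext , λ V≗D → true≢false (trans (sym (V≗D w)) w∈ext) w∉D)
      , card-insert {D = D} w∉D
      , TreeOn-≐ᴬ {G = H ∣ D} {extension ∣ D}
          (≗ᴬ⇒≐ᴬ {H ∣ D} {extension ∣ D} λ i j → sym (∧-assoc-dup (A H i j) (D i) (D j)))
          (λ i → trans (∧-comm (insert D w i) (D i)) (∧-abs-∨ (D i) (does (i ≟ w))))
          restriction-∈-TreeOn

  module TreeOnPlusProperties {H : Graph n} {D : VSet n} {T : Graph n} (plus : TreeOnPlus H D T)
                              {r : Fin n} (root : IsRoot T r) (r∉D : D r ≡ false) where

    tree : IsEnteringTree T
    tree = proj₁ plus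

    T⊆H : T ⊆ᴬ H
    T⊆H = proj₂ (proj₁ (proj₂ plus))

    D⊆T : D ⊆ᵥ V T
    D⊆T = proj₁ (proj₁ (proj₂ (proj₂ plus)))

    outside-D⇒root : ∀ {b} → b ∈ᵥ V T → D b ≡ false → b ≡ r
    outside-D⇒root b∈T b∉D =
      card-≡suc⇒unique-new D⊆T (proj₁ (proj₂ (proj₂ (proj₂ plus)))) b∈T b∉D (proj₁ root) r∉D

    source∈D : ∀ {a b} → Arc T a b → a ∈ᵥ D
    source∈D {a} t with true-or-false (D a)
    ... | inj₁ a∈D = a∈D
    ... | inj₂ a∉D with outside-D⇒root (proj₁ (proj₁ (proj₁ tree) _ _ t)) a∉D
    ... | refl = contradiction t (proj₂ root _)

    leaving-D⇒root : ∀ {a b} → Arc T a b → D b ≡ false → b ≡ r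
    leaving-D⇒root t = outside-D⇒root (proj₂ (proj₁ (proj₁ tree) _ _ t))

    root-entered : ∃ λ a → Arc T a r × a ∈ᵥ D
    root-entered with proj₁ (proj₂ (proj₁ (proj₂ (proj₂ (proj₂ (proj₂ (proj₂ plus)))))))
    ... | u , u∈T∣D = let u∈D = ∧-conicalʳ (V T u) (D u) u∈T∣D in
      walk u∈D (tree-reaches-sink {T} tree (proj₁ root) (proj₂ root) (D⊆T u u∈D))
      where
      walk : ∀ {u} → u ∈ᵥ D → Star (Arc T) u r → ∃ λ a → Arc T a r × a ∈ᵥ D
      walk u∈D ε = contradiction u∈D (λ r∈D → true≢false r∈D r∉D)
      walk {u} u∈D (_◅_ {j = v} t path) with true-or-false (D v)
      ... | inj₁ v∈D = walk v∈D path
      ... | inj₂ v∉D = u , subst (Arc T u) (leaving-D⇒root t v∉D) t , u∈D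

    functional-arc∈T : Functional H → ∀ {a b} → Arc H a b → a ∈ᵥ D → Arc T a b
    functional-arc∈T fnH h a∈D with tree-out-arc {T} {H} tree T⊆H fnH (proj₁ root) (proj₂ root) (D⊆T _ a∈D) h
    ... | inj₁ refl = contradiction a∈D (λ r∈D → true≢false r∈D r∉D)
    ... | inj₂ t    = t

module _ {n m : ℕ} (blk : Fin n → Fin m) where

  Crossing : Graph n → Fin m → Fin m → Set
  Crossing H Z W = ∃₂ λ a b → Arc H a b × blk a ≡ Z × blk b ≡ W

  splitArc⇒crossing : ∀ {H Z W} → SplitArc H blk Z W → Crossing H Z W
  splitArc⇒crossing {H} (Z≢W , T , plus , r , root , r∈W) =
    let (a , t , a∈Z) = root-entered in a , r , T⊆H _ _ t , ∈-block⁻ blk a∈Z , r∈W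
    where open TreeOnPlusProperties {H = H} plus root (∉-block⁺ blk (λ r∈Z → Z≢W (trans (sym r∈Z) r∈W)))

  crossing⇒splitArc : ∀ {H Z W} → IsEnteringForest H → TreeDivisible H blk → Z ≢ W
                    → Crossing H Z W → SplitArc H blk Z W
  crossing⇒splitArc forest divisible Z≢W (a , b , h , refl , refl) =
    Z≢W , extension , extension-∈-TreeOnPlus , b , extension-root , refl
    where open Extension forest (proj₂ (divisible (blk a))) (∈-block⁺ blk refl) (∉-block⁺ blk (Z≢W ∘ sym)) h

  splitArc-transfer : ∀ {G H Z W} → IsEnteringForest H → TreeDivisible H blk
                    → (∀ {a b} → Arc G a b → blk a ≢ blk b → Crossing H (blk a) (blk b))
                    → SplitArc G blk Z W → SplitArc H blk Z W
  splitArc-transfer {G} forest divisible cross split with splitArc⇒crossing {G} split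
  ... | a , b , g , refl , refl = crossing⇒splitArc forest divisible (proj₁ split) (cross g (proj₁ split))

  block-connected : ∀ {H} → TreeDivisible H blk → ∀ {a b} → blk a ≡ blk b → WConn H a b
  block-connected {H} divisible {a} {b} same with divisible (blk a)
  ... | T , (_ , T⊆H) , (_ , _ , connected) , V≗ =
    wconn-⊆ᴬ {G = T} {H} T⊆H
      (connected a b (trans (V≗ a) (∈-block⁺ blk refl)) (trans (V≗ b) (∈-block⁺ blk (sym same))))

  crossing⇒wconn : ∀ {G H} → TreeDivisible H blk
                 → (∀ {a b} → Arc G a b → blk a ≢ blk b → Crossing H (blk a) (blk b))
                 → ∀ a b → Arc G a b → WConn H a b
  crossing⇒wconn divisible cross a b g with blk a ≟ blk b
  ... | yes same = block-connected divisible same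
  ... | no differ with cross g differ
  ... | a′ , b′ , h , a′∈ , b′∈ =
    block-connected divisible (sym a′∈) ◅◅ inj₁ h ◅ block-connected divisible b′∈

module OrdAbGroupProperties (𝔾 : OrdAbGroup) where
  open OrdAbGroup 𝔾
  open ≡-Reasoning

  +-identityʳ : ∀ x → x + 0# ≡ x
  +-identityʳ x = trans (+-comm x 0#) (+-identityˡ x)

  -‿inverseʳ : ∀ x → x - x ≡ 0#
  -‿inverseʳ x = trans (+-comm x (- x)) (-‿inverseˡ x)

  x+y-y≡x : ∀ x y → (x + y) - y ≡ x
  x+y-y≡x x y = begin
    (x + y) - y   ≡⟨ +-assoc x y (- y) ⟩
    x + (y - y)   ≡⟨ cong (x +_) (-‿inverseʳ y) ⟩
    x + 0#        ≡⟨ +-identityʳ x ⟩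
    x             ∎

  x+y-x≡y : ∀ x y → (x + y) - x ≡ y
  x+y-x≡y x y = trans (cong (_- x) (+-comm x y)) (x+y-y≡x y x)

  +-monoʳ-≤ : ∀ {x y} z → x ≤ y → z + x ≤ z + y
  +-monoʳ-≤ {x} {y} z x≤y = subst₂ _≤_ (+-comm x z) (+-comm y z) (+-monoˡ-≤ z x≤y)

  +-cancelʳ-≤ : ∀ {x y} z → x + z ≤ y + z → x ≤ y
  +-cancelʳ-≤ {x} {y} z le = subst₂ _≤_ (x+y-y≡x x z) (x+y-y≡x y z) (+-monoˡ-≤ (- z) le)

  +-interchange : ∀ w x y z → (w + x) + (y + z) ≡ (w + y) + (x + z)
  +-interchange w x y z = begin
    (w + x) + (y + z)   ≡⟨ +-assoc w x (y + z) ⟩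
    w + (x + (y + z))   ≡⟨ cong (w +_) (sym (+-assoc x y z)) ⟩
    w + ((x + y) + z)   ≡⟨ cong (λ v → w + (v + z)) (+-comm x y) ⟩
    w + ((y + x) + z)   ≡⟨ cong (w +_) (+-assoc y x z) ⟩
    w + (y + (x + z))   ≡⟨ sym (+-assoc w y (x + z)) ⟩
    (w + y) + (x + z)   ∎

  x+[-x+y]≡y : ∀ x y → x + ((- x) + y) ≡ y
  x+[-x+y]≡y x y = begin
    x + ((- x) + y)   ≡⟨ sym (+-assoc x (- x) y) ⟩
    (x - x) + y       ≡⟨ cong (_+ y) (-‿inverseʳ x) ⟩
    0# + y            ≡⟨ +-identityˡ y ⟩
    y                 ∎

  -‿antimono-≤ : ∀ {x y} → x ≤ y → - y ≤ - x
  -‿antimono-≤ {x} {y} x≤y = subst₂ _≤_ (x+[-x+y]≡y x (- y)) -x≡ (+-monoˡ-≤ ((- x) + (- y)) x≤y)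
    where
    -x≡ : y + ((- x) + (- y)) ≡ - x
    -x≡ = trans (cong (y +_) (+-comm (- x) (- y))) (x+[-x+y]≡y y (- x))

  x+y≤z⇒y≤z-x : ∀ {x y z} → x + y ≤ z → y ≤ z - x
  x+y≤z⇒y≤z-x {x} {y} le = subst (_≤ _) (x+y-x≡y x y) (+-monoˡ-≤ (- x) le)

  x≤y+z⇒x-y≤z : ∀ {x y z} → x ≤ y + z → x - y ≤ z
  x≤y+z⇒x-y≤z {x} {y} {z} le = subst (_ ≤_) (x+y-x≡y y z) (+-monoˡ-≤ (- y) le)

module WeightProperties (𝔾 : OrdAbGroup) where
  open Weighted 𝔾
  open OrdAbGroupProperties 𝔾

  sumFin-cong : ∀ {n} {f g : Fin n → Carrier} → (∀ i → f i ≡ g i) → sumFin f ≡ sumFin g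
  sumFin-cong {zero}  f≗g = refl
  sumFin-cong {suc n} f≗g = cong₂ _+_ (f≗g zero) (sumFin-cong (f≗g ∘ suc))

  sumFin-0 : ∀ {n} → sumFin {n} (λ _ → 0#) ≡ 0#
  sumFin-0 {zero}  = refl
  sumFin-0 {suc n} = trans (+-identityˡ _) (sumFin-0 {n})

  sumFin-+ : ∀ {n} (f g : Fin n → Carrier) → sumFin (λ i → f i + g i) ≡ sumFin f + sumFin g
  sumFin-+ {zero}  f g = sym (+-identityˡ 0#)
  sumFin-+ {suc n} f g =
    trans (cong (f zero + g zero +_) (sumFin-+ (f ∘ suc) (g ∘ suc))) (+-interchange _ _ _ _)

  sumFin-δ : ∀ {n} (x : Fin n) (f : Fin n → Carrier) → sumFin (λ i → if does (i ≟ x) then f i else 0#) ≡ f x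
  sumFin-δ {suc n} zero    f = trans (cong (f zero +_) (sumFin-0 {n})) (+-identityʳ (f zero))
  sumFin-δ {suc n} (suc x) f = trans (+-identityˡ _) (sumFin-δ x (f ∘ suc))

  weight-⊎ : ∀ a b c (p : Carrier) → (a ≡ true ⇔ (b ≡ true ⊎ c ≡ true)) → (b ≡ true → c ≢ true)
           → (if a ∧ true then p else 0#) ≡ (if b ∧ true then p else 0#) + (if c ∧ true then p else 0#)
  weight-⊎ true  true  true  p _   disjoint = contradiction refl (disjoint refl)
  weight-⊎ true  true  false p _   _ = sym (+-identityʳ p)
  weight-⊎ true  false true  p _   _ = sym (+-identityˡ p)
  weight-⊎ true  false false p a⇔ _ = contradiction (Equivalence.to a⇔ refl) λ { (inj₁ ()) ; (inj₂ ()) }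
  weight-⊎ false true  _     p a⇔ _ = contradiction (Equivalence.from a⇔ (inj₁ refl)) λ ()
  weight-⊎ false false true  p a⇔ _ = contradiction (Equivalence.from a⇔ (inj₂ refl)) λ ()
  weight-⊎ false false false p _   _ = sym (+-identityˡ 0#)

  module _ {n : ℕ} (ψ : Fin n → Fin n → Carrier) where

    Υ-cong : ∀ {G H : Graph n} → G ≐ᴬ H → Υ ψ G ≡ Υ ψ H
    Υ-cong G≐H = sumFin-cong λ i → sumFin-cong λ j →
      cong (λ b → if b ∧ true then ψ i j else 0#) (≡true-ext (G≐H i j))

    Υ-⊎ : ∀ {G G₁ G₂ : Graph n} → (∀ i j → Arc G i j ⇔ (Arc G₁ i j ⊎ Arc G₂ i j))
        → (∀ i j → Arc G₁ i j → ¬ Arc G₂ i j) → Υ ψ G ≡ Υ ψ G₁ + Υ ψ G₂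
    Υ-⊎ {G} {G₁} {G₂} G⇔ disjoint = begin
      Υ ψ G
        ≡⟨ sumFin-cong (λ i → sumFin-cong λ j →
             weight-⊎ (A G i j) (A G₁ i j) (A G₂ i j) (ψ i j) (G⇔ i j) (disjoint i j)) ⟩
      sumFin (λ i → sumFin λ j → term G₁ i j + term G₂ i j)
        ≡⟨ sumFin-cong (λ i → sumFin-+ (term G₁ i) (term G₂ i)) ⟩
      sumFin (λ i → sumFin (term G₁ i) + sumFin (term G₂ i))
        ≡⟨ sumFin-+ (sumFin ∘ term G₁) (sumFin ∘ term G₂) ⟩
      Υ ψ G₁ + Υ ψ G₂
        ∎
      where
      open ≡-Reasoning
      term : Graph n → Fin n → Fin n → Carrier
      term H i j = if A H i j ∧ true then ψ i j else 0#

    Υ-arcGraph : ∀ x y → Υ ψ (arcGraph x y) ≡ ψ x y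
    Υ-arcGraph x y = trans (sumFin-cong row) (sumFin-δ x (λ i → ψ i y))
      where
      row : ∀ i → sumFin (λ j → if A (arcGraph x y) i j ∧ true then ψ i j else 0#)
                ≡ (if does (i ≟ x) then ψ i y else 0#)
      row i with i ≟ x
      ... | yes _ =
        trans (sumFin-cong λ j → cong (λ b → if b then ψ i j else 0#) (∧-identityʳ (does (j ≟ y))))
              (sumFin-δ y (ψ i))
      ... | no _  = sumFin-0 {n}

module PrincipalExit (𝔾 : OrdAbGroup) (n : ℕ) (E : Fin n → Fin n → Bool)
                     (ψ : Fin n → Fin n → OrdAbGroup.Carrier 𝔾) (m : ℕ) (blk : Fin n → Fin m) (k : ℕ)
                     (F′ : Graph m) (F : Graph n) (principal : Weighted.IsPrincipal 𝔾 ψ k E blk F′ F)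
                     (X : Fin m) (x y : Fin n) (x∈X : blk x ≡ X) (y∉X : blk y ≢ X) (xy : Arc F x y) where
  open Weighted 𝔾
  open OrdAbGroupProperties 𝔾
  open WeightProperties 𝔾

  Ψ : Graph n
  Ψ = full E

  VX : VSet n
  VX = block blk X

  private
    F⊆Ψ : F ⊆G Ψ
    F⊆Ψ = proj₁ (proj₂ (proj₁ principal))

    forest : IsEnteringForest F
    forest = proj₁ (proj₂ (proj₂ (proj₁ principal)))

    F-functional : Functional F
    F-functional = proj₁ (proj₂ forest)

    divisible : TreeDivisible F blk
    divisible = proj₁ (proj₂ principal)

    F′⇔split : ∀ Z W → (Arc F′ Z W → SplitArc F blk Z W) × (SplitArc F blk Z W → Arc F′ Z W)
    F′⇔split = proj₂ (proj₂ principal)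

    x∈VX : x ∈ᵥ VX
    x∈VX = ∈-block⁺ blk x∈X

    y∉VX : VX y ≡ false
    y∉VX = ∉-block⁺ blk y∉X

    ∈Y⇒∉VX : ∀ {b} → blk b ≡ blk y → VX b ≡ false
    ∈Y⇒∉VX b∈Y = trans (block-cong blk b∈Y) y∉VX

  open TreeWithExit F-functional (proj₂ (divisible X)) x∈VX y∉VX xy
    using (arc-from-D; restriction-∈-TreeOn)
  open Extension forest (proj₂ (divisible X)) x∈VX y∉VX xy
    using (extension-arc⁻; extension-root; extension-∈-TreeOnPlus) renaming (extension to T₀)

  T₀-∈-TreeXY : TreeXY F blk X (blk y) T₀
  T₀-∈-TreeXY = extension-∈-TreeOnPlus , y , extension-root , refl

  exit-arc∈F′ : Arc F′ X (blk y)
  exit-arc∈F′ = proj₂ (F′⇔split X (blk y)) ((λ X≡Y → y∉X (sym X≡Y)) , T₀ , T₀-∈-TreeXY)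

  Υ-T₀ : Υ ψ T₀ ≡ Υ ψ (F ∣ VX) + ψ x y
  Υ-T₀ = trans (Υ-⊎ ψ {T₀} {F ∣ VX} {arcGraph x y} T₀⇔ disjoint) (cong (Υ ψ (F ∣ VX) +_) (Υ-arcGraph ψ x y))
    where
    T₀⇔ : ∀ i j → Arc T₀ i j ⇔ (Arc (F ∣ VX) i j ⊎ Arc (arcGraph x y) i j)
    T₀⇔ i j = mk⇔ to from
      where
      to : Arc T₀ i j → Arc (F ∣ VX) i j ⊎ Arc (arcGraph x y) i j
      to t with extension-arc⁻ t
      ... | f , i∈X with arc-from-D i∈X f
      ... | inj₁ j∈X          = inj₁ (∧-intro f (∧-intro i∈X j∈X))
      ... | inj₂ (refl , refl) = inj₂ (∧-intro (dec-true (x ≟ x) refl) (dec-true (y ≟ y) refl))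
      from : Arc (F ∣ VX) i j ⊎ Arc (arcGraph x y) i j → Arc T₀ i j
      from (inj₁ r) = let (f , i∈X , _) = ∣-arc⁻ F VX r in ∧-intro f i∈X
      from (inj₂ s) with does-true {i = i} {x} (∧-conicalˡ (does (i ≟ x)) (does (j ≟ y)) s)
                       | does-true {i = j} {y} (∧-conicalʳ (does (i ≟ x)) (does (j ≟ y)) s)
      ... | refl | refl = ∧-intro xy x∈VX
    disjoint : ∀ i j → Arc (F ∣ VX) i j → ¬ Arc (arcGraph x y) i j
    disjoint i j r s with does-true {i = j} {y} (∧-conicalʳ (does (i ≟ x)) (does (j ≟ y)) s)
    ... | refl = true≢false (proj₂ (proj₂ (∣-arc⁻ F VX r))) y∉VX

  F-splitWeight≡ψxy : ∀ a ab → IsLamXY ψ F blk X (blk y) a → IsLamBullet ψ F VX ab → ψ x y ≡ a - ab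
  F-splitWeight≡ψxy a ab ((Ta , (plus , r , root , r∈Y) , Υ≡a) , _) ((Tb , onX , Υ≡ab) , _) =
    sym (trans (cong₂ _-_ a≡ ab≡) (x+y-x≡y (Υ ψ (F ∣ VX)) (ψ x y)))
    where
    open TreeOnPlusProperties plus root (∈Y⇒∉VX r∈Y)
    Ta≐T₀ : Ta ≐ᴬ T₀
    Ta≐T₀ i j = mk⇔ (λ t → ∧-intro (T⊆H i j t) (source∈D t))
                    (λ t → let (f , i∈X) = extension-arc⁻ t in functional-arc∈T F-functional f i∈X)
    a≡ : a ≡ Υ ψ (F ∣ VX) + ψ x y
    a≡ = trans (sym Υ≡a) (trans (Υ-cong ψ {Ta} {T₀} Ta≐T₀) Υ-T₀)
    ab≡ : ab ≡ Υ ψ (F ∣ VX)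
    ab≡ = trans (sym Υ≡ab)
                (Υ-cong ψ {Tb} {F ∣ VX} (TreeWithExit.tree≐restriction F-functional onX x∈VX y∉VX xy))

  module Replacement (F′-acyclic : Acyclic (Arc F′)) (Tl : Graph n) (tl : TreeXY Ψ blk X (blk y) Tl) where

    private
      r : Fin n
      r = proj₁ (proj₂ tl)

      r∈Y : blk r ≡ blk y
      r∈Y = proj₂ (proj₂ (proj₂ tl))

    open TreeOnPlusProperties (proj₁ tl) (proj₁ (proj₂ (proj₂ tl))) (∈Y⇒∉VX r∈Y)

    G : Graph n
    G = record { V = λ _ → true ; A = λ i j → if VX i then A Tl i j else A F i j }

    Outside : Graph n
    Outside = record { V = λ _ → true ; A = λ i j → A F i j ∧ not (VX i) }

    private
      G-arc-X⁺ : ∀ {a b} → a ∈ᵥ VX → Arc Tl a b → Arc G a b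
      G-arc-X⁺ a∈X rewrite a∈X = λ t → t

      G-arc-X⁻ : ∀ {a b} → a ∈ᵥ VX → Arc G a b → Arc Tl a b
      G-arc-X⁻ a∈X rewrite a∈X = λ g → g

      G-arc-∉X⁺ : ∀ {a b} → VX a ≡ false → Arc F a b → Arc G a b
      G-arc-∉X⁺ a∉X rewrite a∉X = λ f → f

      G-arc-∉X⁻ : ∀ {a b} → VX a ≡ false → Arc G a b → Arc F a b
      G-arc-∉X⁻ a∉X rewrite a∉X = λ g → g

      outside-arc⁻ : ∀ {i j} → Arc Outside i j → Arc F i j × VX i ≡ false
      outside-arc⁻ {i} {j} o =
        ∧-conicalˡ (A F i j) (not (VX i)) o , not-injective (∧-conicalʳ (A F i j) (not (VX i)) o)

    G-functional : Functional G
    G-functional i j j′ g g′ with true-or-false (VX i)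
    ... | inj₁ i∈X = proj₁ (proj₂ (proj₁ tree)) i j j′ (G-arc-X⁻ i∈X g) (G-arc-X⁻ i∈X g′)
    ... | inj₂ i∉X = F-functional i j j′ (G-arc-∉X⁻ i∉X g) (G-arc-∉X⁻ i∉X g′)

    -- The only arc of G leaving X ends in blk y, like the arc (x , y) of F.
    crossing-G⇒F : ∀ {a b} → Arc G a b → blk a ≢ blk b → Crossing blk F (blk a) (blk b)
    crossing-G⇒F {a} {b} g differ with true-or-false (VX a)
    ... | inj₂ a∉X = a , b , G-arc-∉X⁻ a∉X g , refl , refl
    ... | inj₁ a∈X with true-or-false (VX b)
    ... | inj₁ b∈X = contradiction (trans (∈-block⁻ blk a∈X) (sym (∈-block⁻ blk b∈X))) differ
    ... | inj₂ b∉X =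
      x , y , xy , trans x∈X (sym (∈-block⁻ blk a∈X))
      , trans (sym r∈Y) (cong blk (sym (leaving-D⇒root (G-arc-X⁻ a∈X g) b∉X)))

    crossing-F⇒G : ∀ {a b} → Arc F a b → blk a ≢ blk b → Crossing blk G (blk a) (blk b)
    crossing-F⇒G {a} {b} f differ with true-or-false (VX a)
    ... | inj₂ a∉X = a , b , G-arc-∉X⁺ a∉X f , refl , refl
    ... | inj₁ a∈X with arc-from-D a∈X f
    ... | inj₁ b∈X = contradiction (trans (∈-block⁻ blk a∈X) (sym (∈-block⁻ blk b∈X))) differ
    ... | inj₂ (refl , refl) =
      let (x′ , t , x′∈X) = root-entered
      in x′ , r , G-arc-X⁺ x′∈X t , trans (∈-block⁻ blk x′∈X) (sym x∈X) , r∈Y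

    G-divisible : TreeDivisible G blk
    G-divisible Z with Z ≟ X
    ... | yes refl =
      Tl ∣ VX
      , TreeOn-⊆ᴬ {H = Ψ} {G} (λ _ → refl)
          (λ a b t → let (t′ , a∈X , _) = ∣-arc⁻ Tl VX t in G-arc-X⁺ a∈X t′)
          (proj₂ (proj₂ (proj₂ (proj₂ (proj₁ tl)))))
    ... | no Z≢X with divisible Z
    ... | TZ , onZ@((_ , TZ⊆F) , ((wf , _) , _) , V≗Z) =
      TZ
      , TreeOn-⊆ᴬ {H = F} {G} (λ _ → refl)
          (λ a b t → G-arc-∉X⁺ (∉-block⁺ blk (Z≢X ∘ trans (sym (a∈Z t)))) (TZ⊆F a b t)) onZ
      where
      a∈Z : ∀ {a b} → Arc TZ a b → blk a ≡ Z
      a∈Z t = ∈-block⁻ blk (trans (sym (V≗Z _)) (proj₁ (wf _ _ t)))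

    G-acyclic : Acyclic (Arc G)
    G-acyclic = acyclic-by-blocks blk step F′-acyclic inside-acyclic
      where
      step : ∀ {a b} → Arc G a b → blk a ≡ blk b ⊎ Arc F′ (blk a) (blk b)
      step {a} {b} g with blk a ≟ blk b
      ... | yes same  = inj₁ same
      ... | no differ = inj₂ (proj₂ (F′⇔split (blk a) (blk b))
                          (crossing⇒splitArc blk forest divisible differ (crossing-G⇒F g differ)))
      inside-acyclic : Acyclic (Inside blk (Arc G))
      inside-acyclic i cycle with true-or-false (VX i)
      ... | inj₁ i∈X = proj₂ (proj₂ (proj₁ tree)) i
                         (inside⁺⇒ blk (λ a∈X → G-arc-X⁻ (∈-block⁺ blk a∈X)) (∈-block⁻ blk i∈X) cycle)
      ... | inj₂ i∉X = proj₂ (proj₂ forest) i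
                         (inside⁺⇒ blk (λ a∈Z → G-arc-∉X⁻ (trans (block-cong blk a∈Z) i∉X)) refl cycle)

    G-forest : IsEnteringForest G
    G-forest = (λ _ _ _ → refl , refl) , G-functional , G-acyclic

    G-principal : IsPrincipal ψ k E blk F′ G
    G-principal =
      ( (λ _ → refl)
      , ((λ _ _ → refl) , G⊆Ψ)
      , G-forest
      , HasComponents-transfer {G = F} {H = G} (λ i → sym (proj₁ (proj₁ principal) i))
          (crossing⇒wconn blk {F} {G} G-divisible crossing-F⇒G)
          (crossing⇒wconn blk {G} {F} divisible crossing-G⇒F)
          (proj₂ (proj₂ (proj₂ (proj₁ principal)))))
      , G-divisible
      , λ Z W → (splitArc-transfer blk G-forest G-divisible crossing-F⇒G ∘ proj₁ (F′⇔split Z W))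
              , (proj₂ (F′⇔split Z W) ∘ splitArc-transfer blk forest divisible crossing-G⇒F)
      where
      G⊆Ψ : ∀ a b → Arc G a b → Arc Ψ a b
      G⊆Ψ a b g with true-or-false (VX a)
      ... | inj₁ a∈X = T⊆H a b (G-arc-X⁻ a∈X g)
      ... | inj₂ a∉X = proj₂ F⊆Ψ a b (G-arc-∉X⁻ a∉X g)

    Υ-F : Υ ψ F ≡ Υ ψ T₀ + Υ ψ Outside
    Υ-F = Υ-⊎ ψ {F} {T₀} {Outside} F⇔
            λ i j t o → true≢false (proj₂ (extension-arc⁻ t)) (proj₂ (outside-arc⁻ o))
      where
      F⇔ : ∀ i j → Arc F i j ⇔ (Arc T₀ i j ⊎ Arc Outside i j)
      F⇔ i j = mk⇔ to from
        where
        to : Arc F i j → Arc T₀ i j ⊎ Arc Outside i j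
        to f with true-or-false (VX i)
        ... | inj₁ i∈X = inj₁ (∧-intro f i∈X)
        ... | inj₂ i∉X = inj₂ (∧-intro f (cong not i∉X))
        from : Arc T₀ i j ⊎ Arc Outside i j → Arc F i j
        from (inj₁ t) = proj₁ (extension-arc⁻ t)
        from (inj₂ o) = proj₁ (outside-arc⁻ o)

    Υ-G : Υ ψ G ≡ Υ ψ Tl + Υ ψ Outside
    Υ-G = Υ-⊎ ψ {G} {Tl} {Outside} G⇔ λ i j t o → true≢false (source∈D t) (proj₂ (outside-arc⁻ o))
      where
      G⇔ : ∀ i j → Arc G i j ⇔ (Arc Tl i j ⊎ Arc Outside i j)
      G⇔ i j = mk⇔ to from
        where
        to : Arc G i j → Arc Tl i j ⊎ Arc Outside i j
        to g with true-or-false (VX i)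
        ... | inj₁ i∈X = inj₁ (G-arc-X⁻ i∈X g)
        ... | inj₂ i∉X = inj₂ (∧-intro (G-arc-∉X⁻ i∉X g) (cong not i∉X))
        from : Arc Tl i j ⊎ Arc Outside i j → Arc G i j
        from (inj₁ t) = G-arc-X⁺ (source∈D t) t
        from (inj₂ o) = let (f , i∉X) = outside-arc⁻ o in G-arc-∉X⁺ i∉X f

  private
    F∣X-∈-TreeOnΨ : TreeOn Ψ VX (F ∣ VX)
    F∣X-∈-TreeOnΨ = TreeOn-⊆G {H = F} {Ψ} F⊆Ψ restriction-∈-TreeOn

    λ•≤Υ-F∣X : ∀ {lb} → IsLamBullet ψ Ψ VX lb → lb ≤ Υ ψ (F ∣ VX)
    λ•≤Υ-F∣X lamB = proj₂ lamB (F ∣ VX) F∣X-∈-TreeOnΨ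

  module _ (F′-acyclic : Acyclic (Arc F′)) (minimal : ∀ G → IsPrincipal ψ k E blk F′ G → Υ ψ F ≤ Υ ψ G) where

    ψxy≤splitWeight : ∀ l lb → IsLamXY ψ Ψ blk X (blk y) l → IsLamBullet ψ Ψ VX lb → ψ x y ≤ l - lb
    ψxy≤splitWeight l lb ((Tl , tl , Υ≡l) , _) lamB =
      ≤-trans (x+y≤z⇒y≤z-x B+ψxy≤l) (+-monoʳ-≤ l (-‿antimono-≤ (λ•≤Υ-F∣X lamB)))
      where
      open Replacement F′-acyclic Tl tl
      -- Υ F ≤ Υ G, and both sides share the arcs leaving vertices outside X.
      B+ψxy≤l : Υ ψ (F ∣ VX) + ψ x y ≤ l
      B+ψxy≤l = +-cancelʳ-≤ (Υ ψ Outside)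
        (subst₂ _≤_ (trans Υ-F (cong (_+ Υ ψ Outside) Υ-T₀)) (trans Υ-G (cong (_+ Υ ψ Outside) Υ≡l))
                (minimal G G-principal))

    splitWeight≡ψxy : IsTildeTree ψ Ψ VX (F ∣ VX)
                    → ∀ l lb → IsLamXY ψ Ψ blk X (blk y) l → IsLamBullet ψ Ψ VX lb → l - lb ≡ ψ x y
    splitWeight≡ψxy (_ , F∣X-minimal) l lb lamXY lamB@((Tb , onX , Υ≡lb) , _) =
      ≤-antisym l-lb≤ψxy (ψxy≤splitWeight l lb lamXY lamB)
      where
      lb≡B : lb ≡ Υ ψ (F ∣ VX)
      lb≡B = ≤-antisym (λ•≤Υ-F∣X lamB) (subst (Υ ψ (F ∣ VX) ≤_) Υ≡lb (F∣X-minimal Tb onX))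
      l≤B+ψxy : l ≤ Υ ψ (F ∣ VX) + ψ x y
      l≤B+ψxy = subst (l ≤_) Υ-T₀
        (proj₂ lamXY T₀ (TreeOnPlus-⊆G {H = F} {Ψ} F⊆Ψ extension-∈-TreeOnPlus , y , extension-root , refl))
      l-lb≤ψxy : l - lb ≤ ψ x y
      l-lb≤ψxy = subst (λ b → l - b ≤ ψ x y) (sym lb≡B) (x≤y+z⇒x-y≤z l≤B+ψxy)

theorem2 : (𝔾 : OrdAbGroup) → let open Weighted 𝔾 in
    (n : ℕ) (E : Fin n → Fin n → Bool) (ψ : Fin n → Fin n → Carrier)
    (m : ℕ) (blk : Fin n → Fin m) → IsPartition blk → TreeDivisible (full E) blk →
    (k : ℕ) (F′ : Graph m) → InSplitForests k (full E) blk F′ →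
    (F : Graph n) → IsMinimalPrincipal ψ k E blk F′ F →
    (X : Fin m) → (∀ i → blk i ≡ X → ∃ λ j → Arc F i j) →
    (x y : Fin n) → blk x ≡ X → blk y ≢ X → Arc F x y →
    -- (X , blk y) is an arc of F′, so f′_XY = ψ^ℵ_XY is defined
    Arc F′ X (blk y)
    -- ψ^ℵ_XY ≥ ψ_xy
    × (∀ l lb → IsLamXY ψ (full E) blk X (blk y) l → IsLamBullet ψ (full E) (block blk X) lb →
         ψ x y ≤ l - lb)
    -- (X , blk y) is an arc of F^ℵ and f^ℵ_XY = ψ_xy
    × (∃ λ T → TreeXY F blk X (blk y) T)
    × (∀ a ab → IsLamXY ψ F blk X (blk y) a → IsLamBullet ψ F (block blk X) ab →
         ψ x y ≡ a - ab)
    -- equality when F|_X ∈ 𝒯~•_X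
    × (IsTildeTree ψ (full E) (block blk X) (F ∣ block blk X) →
         ∀ l lb → IsLamXY ψ (full E) blk X (blk y) l → IsLamBullet ψ (full E) (block blk X) lb →
           l - lb ≡ ψ x y)
theorem2 𝔾 n E ψ m blk _ _ k F′ (_ , _ , (_ , _ , F′-acyclic) , _) F (principal , minimal)
         X _ x y x∈X y∉X xy =
  exit-arc∈F′ , ψxy≤splitWeight F′-acyclic minimal , (_ , T₀-∈-TreeXY) , F-splitWeight≡ψxy
  , splitWeight≡ψxy F′-acyclic minimal
  where open PrincipalExit 𝔾 n E ψ m blk k F′ F principal X x y x∈X y∉X xy
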